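{- (Binet's formula) Let $k>0$ be a real number, $\alpha=1+\sqrt{1+k}$, $\beta=1-\sqrt{1+k}$, and set $\hat\alpha=1+i\,\alpha+\varepsilon\,\alpha^2+i\,\varepsilon\,\alpha^3$ and $\hat\beta=1+i\,\beta+\varepsilon\,\beta^2+i\,\varepsilon\,\beta^3$. Then for every integer $n\ge1$, $$Q_{P_{k,n}}=\frac{1}{\alpha-\beta}\left(\hat\alpha\,\alpha^n-\hat\beta\,\beta^n\right).$$
   Context: Dual-complex numbers are expressions $x_1+i\,x_2+\varepsilon\,y_1+i\,\varepsilon\,y_2$ with $x_1,x_2,y_1,y_2$ real, forming the commutative ring $\mathbb{C}[\varepsilon]/(\varepsilon^2)$: $i^2=-1$, $\varepsilon\neq 0$, $\varepsilon^2=0$, $(i\varepsilon)^2=0$. The $k$-Pell numbers are defined by $P_{k,0}=0$, $P_{k,1}=1$, $P_{k,n+1}=2P_{k,n}+kP_{k,n-1}$ for $n\ge1$. The dual-complex $k$-Pell quaternion is $Q_{P_{k,n}}=P_{k,n}+i\,P_{k,n+1}+\varepsilon\,P_{k,n+2}+i\,\varepsilon\,P_{k,n+3}$. -}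

module Defs where

open import Level using (Level)
open import Data.Nat using (ℕ; zero; suc)
open import Data.Product using (_×_)
open import Algebra.Bundles using (CommutativeRing)

-- Everything is developed over an arbitrary commutative ring R of scalars
-- (standing in for the real numbers, which agda-stdlib does not provide).
module DualComplex {c ℓ : Level} (R : CommutativeRing c ℓ) where
  open CommutativeRing R

  -- dual-complex number  x1 + i x2 + ε y1 + i ε y2
  record DC : Set c where
    constructor dc
    field
      x1 x2 y1 y2 : Carrier
  open DC public

  _≈DC_ : DC → DC → Set ℓ
  a ≈DC b = (x1 a ≈ x1 b) × (x2 a ≈ x2 b) × (y1 a ≈ y1 b) × (y2 a ≈ y2 b)

  ι : Carrier → DC
  ι r = dc r 0# 0# 0#

  _+DC_ : DC → DC → DC
  a +DC b = dc (x1 a + x1 b) (x2 a + x2 b) (y1 a + y1 b) (y2 a + y2 b)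

  -DC_ : DC → DC
  -DC a = dc (- x1 a) (- x2 a) (- y1 a) (- y2 a)

  _-DC_ : DC → DC → DC
  a -DC b = a +DC (-DC b)

  -- multiplication in C[ε]/(ε²), i² = -1:
  -- (z + ε w)(z' + ε w') = z z' + ε (z w' + w z'),  z = x1 + i x2, w = y1 + i y2
  _*DC_ : DC → DC → DC
  a *DC b = dc
    (x1 a * x1 b - x2 a * x2 b)
    (x1 a * x2 b + x2 a * x1 b)
    ((x1 a * y1 b - x2 a * y2 b) + (y1 a * x1 b - y2 a * x2 b))
    ((x1 a * y2 b + x2 a * y1 b) + (y1 a * x2 b + y2 a * x1 b))

  _^_ : Carrier → ℕ → Carrier
  a ^ zero = 1#
  a ^ suc n = a * (a ^ n)

  pell : Carrier → ℕ → Carrier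
  pell k zero = 0#
  pell k (suc zero) = 1#
  pell k (suc (suc n)) = (1# + 1#) * pell k (suc n) + k * pell k n

  Q : Carrier → ℕ → DC
  Q k n = dc (pell k n) (pell k (suc n)) (pell k (suc (suc n))) (pell k (suc (suc (suc n))))

  hat : Carrier → DC
  hat a = dc 1# a (a ^ 2) (a ^ 3)

module Submission where

-- Binet's formula for the dual-complex k-Pell quaternions, over an
-- arbitrary commutative ring R in which s² = 1 + k and α - β is
-- invertible, where α = 1 + s, β = 1 - s.
--
-- Scalar part: say that u : ℕ → R satisfies the recurrence
-- (t, k) if u (n + 2) ≈ t u (n + 1) + k u n.  Such a sequence is
-- determined by its first two values; if a and b are roots of
-- x² = t x + k then n ↦ aⁿ and n ↦ bⁿ satisfy it, and the solutions are
-- closed under differences and scalar multiples.  Hence every solution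
-- with u 0 = 0, u 1 = 1 equals d (aⁿ - bⁿ) when d (a - b) = 1 (scalar
-- Binet).  The k-Pell numbers satisfy the recurrence (2, k), and
-- 1 ± s are roots of x² = 2 x + k because s² = 1 + k.
--
-- Dual-complex part: multiplying by an embedded scalar ι r is scaling
-- of the four components, so  α̂ ι(αⁿ)  is the vector of consecutive
-- powers (αⁿ, αⁿ⁺¹, αⁿ⁺², αⁿ⁺³), and the right-hand side of the theorem
-- is d times the difference of two such vectors.  Componentwise this is
-- scalar Binet applied at n, n + 1, n + 2, n + 3, i.e. exactly Q k n.

open import Defs
open import Level using (Level)
open import Data.Nat using (ℕ; _≥_; zero; suc)
import Data.Nat as Nat
open import Data.Product using (_,_)
open import Algebra.Bundles using (CommutativeRing)
import Algebra.Properties.Ring as RingProperties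
import Algebra.Properties.CommutativeSemigroup as CommutativeSemigroupProperties
import Algebra.Solver.Ring.NaturalCoefficients.Default as SemiringSolver
import Relation.Binary.Reasoning.Setoid as SetoidReasoning

module BinetFormula {c ℓ : Level} (R : CommutativeRing c ℓ) where
  open CommutativeRing R hiding (zero)
  open DualComplex R
  open RingProperties ring
    using (-0#≈0#; -‿+-comm; -‿distribˡ-*; -‿distribʳ-*; -‿involutive; x[y-z]≈xy-xz)
  open CommutativeSemigroupProperties +-commutativeSemigroup using (interchange)
  open CommutativeSemigroupProperties *-commutativeSemigroup using (x∙yz≈y∙xz)
  open SemiringSolver commutativeSemiring using (solve; _:=_; _:+_; _:*_; con)
  open SetoidReasoning setoid

  +-dropʳ : ∀ {x y} → y ≈ 0# → x + y ≈ x
  +-dropʳ {x} y≈0 = trans (+-congˡ y≈0) (+-identityʳ x)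

  +-dropˡ : ∀ {x y} → x ≈ 0# → x + y ≈ y
  +-dropˡ {y = y} x≈0 = trans (+-congʳ x≈0) (+-identityˡ y)

  −-dropʳ : ∀ {x y} → y ≈ 0# → x - y ≈ x
  −-dropʳ y≈0 = +-dropʳ (trans (-‿cong y≈0) -0#≈0#)

  sum-sub-sum : ∀ p q r t → (p + q) - (r + t) ≈ (p - r) + (q - t)
  sum-sub-sum p q r t = begin
    (p + q) + - (r + t)     ≈⟨ +-congˡ (-‿+-comm r t) ⟨
    (p + q) + (- r + - t)   ≈⟨ interchange p q (- r) (- t) ⟩
    (p - r) + (q - t)       ∎

  ^-+ : ∀ a m n → (a ^ m) * (a ^ n) ≈ a ^ (m Nat.+ n)
  ^-+ a zero    n = *-identityˡ (a ^ n)
  ^-+ a (suc m) n = trans (*-assoc a (a ^ m) (a ^ n)) (*-congˡ (^-+ a m n))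

  Satisfies : Carrier → Carrier → (ℕ → Carrier) → Set ℓ
  Satisfies t k u = ∀ n → u (suc (suc n)) ≈ t * u (suc n) + k * u n

  recurrence-unique : ∀ {t k u v} → Satisfies t k u → Satisfies t k v →
    u 0 ≈ v 0 → u 1 ≈ v 1 → ∀ n → u n ≈ v n
  recurrence-unique su sv u0 u1 zero          = u0
  recurrence-unique su sv u0 u1 (suc zero)    = u1
  recurrence-unique su sv u0 u1 (suc (suc n)) =
    trans (su n) (trans (+-cong (*-congˡ (same (suc n))) (*-congˡ (same n))) (sym (sv n)))
    where same = recurrence-unique su sv u0 u1

  powers-satisfy : ∀ {t k a} → a * a ≈ t * a + k → Satisfies t k (a ^_)
  powers-satisfy {t} {k} {a} root n = begin
    a * (a * a ^ n)           ≈⟨ *-assoc a a (a ^ n) ⟨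
    (a * a) * a ^ n           ≈⟨ *-congʳ root ⟩
    (t * a + k) * a ^ n       ≈⟨ distribʳ (a ^ n) (t * a) k ⟩
    t * a * a ^ n + k * a ^ n ≈⟨ +-congʳ (*-assoc t a (a ^ n)) ⟩
    t * (a * a ^ n) + k * a ^ n ∎

  difference-satisfies : ∀ {t k u v} → Satisfies t k u → Satisfies t k v →
    Satisfies t k (λ n → u n - v n)
  difference-satisfies {t} {k} {u} {v} su sv n = begin
    u (suc (suc n)) - v (suc (suc n))                                   ≈⟨ +-cong (su n) (-‿cong (sv n)) ⟩
    (t * u (suc n) + k * u n) - (t * v (suc n) + k * v n)   ≈⟨ sum-sub-sum _ _ _ _ ⟩
    (t * u (suc n) - t * v (suc n)) + (k * u n - k * v n)   ≈⟨ +-cong (x[y-z]≈xy-xz t _ _) (x[y-z]≈xy-xz k _ _) ⟨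
    t * (u (suc n) - v (suc n)) + k * (u n - v n)           ∎

  scaling-satisfies : ∀ {t k u} d → Satisfies t k u → Satisfies t k (λ n → d * u n)
  scaling-satisfies {t} {k} {u} d su n = begin
    d * u (suc (suc n))                             ≈⟨ *-congˡ (su n) ⟩
    d * (t * u (suc n) + k * u n)             ≈⟨ distribˡ d _ _ ⟩
    d * (t * u (suc n)) + d * (k * u n)       ≈⟨ +-cong (x∙yz≈y∙xz d t _) (x∙yz≈y∙xz d k _) ⟩
    t * (d * u (suc n)) + k * (d * u n)       ∎

  binet : ∀ {t k a b d u} → Satisfies t k u → u 0 ≈ 0# → u 1 ≈ 1# →
    a * a ≈ t * a + k → b * b ≈ t * b + k → d * (a - b) ≈ 1# →
    ∀ n → u n ≈ d * (a ^ n - b ^ n)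
  binet {a = a} {b} {d} su u0 u1 root-a root-b inverse =
    recurrence-unique su
      (scaling-satisfies d (difference-satisfies (powers-satisfy root-a) (powers-satisfy root-b)))
      (trans u0 (sym (trans (*-congˡ (-‿inverseʳ 1#)) (zeroʳ d))))
      (trans u1 (sym (trans (*-congˡ (+-cong (*-identityʳ a) (-‿cong (*-identityʳ b)))) inverse)))

  pell-satisfies : ∀ k → Satisfies (1# + 1#) k (pell k)
  pell-satisfies k n = refl

  shifted-root : ∀ {k} x → x * x ≈ 1# + k → (1# + x) * (1# + x) ≈ (1# + 1#) * (1# + x) + k
  shifted-root {k} x square = begin
    (1# + x) * (1# + x)               ≈⟨ expand x ⟩
    (1# + 1#) * x + (1# + x * x)       ≈⟨ +-congˡ (+-congˡ square) ⟩
    (1# + 1#) * x + (1# + (1# + k))    ≈⟨ collect x k ⟩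
    (1# + 1#) * (1# + x) + k           ∎
    where
    expand : ∀ x → (1# + x) * (1# + x) ≈ (1# + 1#) * x + (1# + x * x)
    expand = solve 1 (λ x →
      (con 1 :+ x) :* (con 1 :+ x) := (con 1 :+ con 1) :* x :+ (con 1 :+ x :* x)) refl
    collect : ∀ x k → (1# + 1#) * x + (1# + (1# + k)) ≈ (1# + 1#) * (1# + x) + k
    collect = solve 2 (λ x k →
      (con 1 :+ con 1) :* x :+ (con 1 :+ (con 1 :+ k)) := (con 1 :+ con 1) :* (con 1 :+ x) :+ k) refl

  -- Needed to see that 1 - s is a root as well: (-s)² = s².
  neg-square : ∀ x → (- x) * (- x) ≈ x * x
  neg-square x = begin
    (- x) * (- x)   ≈⟨ -‿distribˡ-* x (- x) ⟨
    - (x * - x)     ≈⟨ -‿cong (-‿distribʳ-* x x) ⟨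
    - (- (x * x))   ≈⟨ -‿involutive (x * x) ⟩
    x * x           ∎

  ≈DC-sym : ∀ {X Y} → X ≈DC Y → Y ≈DC X
  ≈DC-sym (e1 , e2 , e3 , e4) = sym e1 , sym e2 , sym e3 , sym e4

  ≈DC-trans : ∀ {X Y Z} → X ≈DC Y → Y ≈DC Z → X ≈DC Z
  ≈DC-trans (e1 , e2 , e3 , e4) (f1 , f2 , f3 , f4) =
    trans e1 f1 , trans e2 f2 , trans e3 f3 , trans e4 f4

  infixr 30 _·_
  _·_ : Carrier → DC → DC
  r · X = dc (r * x1 X) (r * x2 X) (r * y1 X) (r * y2 X)

  ·-cong : ∀ r {X Y} → X ≈DC Y → r · X ≈DC r · Y
  ·-cong r (e1 , e2 , e3 , e4) = *-congˡ e1 , *-congˡ e2 , *-congˡ e3 , *-congˡ e4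

  -DC-cong : ∀ {X X′ Y Y′} → X ≈DC X′ → Y ≈DC Y′ → (X -DC Y) ≈DC (X′ -DC Y′)
  -DC-cong (e1 , e2 , e3 , e4) (f1 , f2 , f3 , f4) =
    +-cong e1 (-‿cong f1) , +-cong e2 (-‿cong f2) , +-cong e3 (-‿cong f3) , +-cong e4 (-‿cong f4)

  ι-mulˡ : ∀ r X → (ι r *DC X) ≈DC r · X
  ι-mulˡ r X =
      −-dropʳ (zeroˡ _)
    , +-dropʳ (zeroˡ _)
    , trans (+-dropʳ (trans (−-dropʳ (zeroˡ _)) (zeroˡ _))) (−-dropʳ (zeroˡ _))
    , trans (+-dropʳ (trans (+-dropʳ (zeroˡ _)) (zeroˡ _))) (+-dropʳ (zeroˡ _))

  ι-mulʳ : ∀ r X → (X *DC ι r) ≈DC r · X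
  ι-mulʳ r X =
      trans (−-dropʳ (zeroʳ _)) (*-comm _ r)
    , trans (+-dropˡ (zeroʳ _)) (*-comm _ r)
    , trans (+-dropˡ (trans (−-dropʳ (zeroʳ _)) (zeroʳ _)))
            (trans (−-dropʳ (zeroʳ _)) (*-comm _ r))
    , trans (+-dropˡ (trans (+-dropʳ (zeroʳ _)) (zeroʳ _)))
            (trans (+-dropˡ (zeroʳ _)) (*-comm _ r))

  powers : Carrier → ℕ → DC
  powers a n = dc (a ^ n) (a ^ suc n) (a ^ suc (suc n)) (a ^ suc (suc (suc n)))

  hat-scale : ∀ a n → (hat a *DC ι (a ^ n)) ≈DC powers a n
  hat-scale a n = ≈DC-trans (ι-mulʳ (a ^ n) (hat a))
    ( *-identityʳ (a ^ n)
    , *-comm (a ^ n) a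
    , trans (*-comm (a ^ n) (a ^ 2)) (^-+ a 2 n)
    , trans (*-comm (a ^ n) (a ^ 3)) (^-+ a 3 n) )

  module _ (k s d : Carrier) (square : s * s ≈ 1# + k)
           (inverse : d * ((1# + s) - (1# - s)) ≈ 1#) where

    pell-binet : ∀ n → pell k n ≈ d * ((1# + s) ^ n - (1# - s) ^ n)
    pell-binet = binet (pell-satisfies k) refl refl
      (shifted-root s square) (shifted-root (- s) (trans (neg-square s) square)) inverse

    Q-binet : ∀ n → Q k n ≈DC d · (powers (1# + s) n -DC powers (1# - s) n)
    Q-binet n = pell-binet n , pell-binet (suc n) , pell-binet (suc (suc n)) , pell-binet (suc (suc (suc n)))

    dualComplexBinet : ∀ n →
      Q k n ≈DC (ι d *DC ((hat (1# + s) *DC ι ((1# + s) ^ n)) -DC (hat (1# - s) *DC ι ((1# - s) ^ n))))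
    dualComplexBinet n = ≈DC-trans (Q-binet n) (≈DC-sym
      (≈DC-trans (ι-mulˡ d _) (·-cong d (-DC-cong (hat-scale (1# + s) n) (hat-scale (1# - s) n)))))

mainTheorem3 : {c ℓ : Level} (R : CommutativeRing c ℓ) →
  let open CommutativeRing R
      open DualComplex R
  in
  (k s d : Carrier) →
  s * s ≈ 1# + k →
  d * ((1# + s) - (1# - s)) ≈ 1# →
  (n : ℕ) → n ≥ 1 →
  Q k n ≈DC (ι d *DC ((hat (1# + s) *DC ι ((1# + s) ^ n)) -DC (hat (1# - s) *DC ι ((1# - s) ^ n))))
-- The formula holds for every n.
mainTheorem3 R k s d square inverse n _ = BinetFormula.dualComplexBinet R k s d square inverse n
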